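{- There is an absolute constant $C>0$ such that for every odd prime power $q$ and every monic irreducible $p\in\mathbb F_q[T]$, the number of $\mathbb F_p$-isomorphism classes of rank 2 Drinfeld modules over $\mathbb F_p$ that contain a representative of the form $\phi(0,\delta)$ for some $\delta\in\mathbb F_p$ is at most $Cq^2$.
   Context: $A=\mathbb F_q[T]$, $\mathbb F_p=A/pA$, $\hat T$ the image of $T$ in $\mathbb F_p$. $\mathbb F_p\{\tau\}$ is the twisted polynomial ring with $\tau\alpha=\alpha^q\tau$. For $\gamma,\delta\in\mathbb F_p$, $\phi(\gamma,\delta)$ is the Drinfeld module $A\to\mathbb F_p\{\tau\}$, $T\mapsto\hat T+\gamma\tau+\delta\tau^2$, of rank 2 when $\delta\neq0$. Two such Drinfeld modules $\phi,\psi$ are $\mathbb F_p$-isomorphic if there is $\mu\in\mathbb F_p^*$ with $\mu\phi_T=\psi_T\mu$ in $\mathbb F_p\{\tau\}$. -}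

module Defs where

open import Level using (0ℓ)
open import Algebra.Bundles using (CommutativeRing)
open import Data.Nat as ℕ using (ℕ; zero; suc; _≤_; _%_)
open import Data.Nat.Primality using (Prime)
open import Data.Fin using (Fin)
open import Data.List using (List; []; _∷_; map; _++_; [_])
open import Data.List.Relation.Unary.All using (All)
open import Data.List.Relation.Unary.AllPairs using (AllPairs)
open import Data.Product using (Σ; _×_; _,_; ∃)
open import Data.Sum using (_⊎_)
open import Relation.Nullary using (¬_)
open import Relation.Binary.PropositionalEquality using (_≡_)

OddPrimePower : ℕ → Set
OddPrimePower q =
  Σ ℕ λ ℓ → Σ ℕ λ k → Prime ℓ × 1 ≤ k × q ≡ ℓ ℕ.^ k × q % 2 ≡ 1

module _ (F : CommutativeRing 0ℓ 0ℓ) where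
  open CommutativeRing F

  IsField : Set
  IsField = ¬ (1# ≈ 0#) × (∀ x → ¬ (x ≈ 0#) → ∃ λ y → x * y ≈ 1#)

  HasCard : ℕ → Set
  HasCard q = Σ (Fin q → Carrier) λ e →
    (∀ i j → e i ≈ e j → i ≡ j) × (∀ x → ∃ λ i → e i ≈ x)

  -- A = F[T] : polynomials as coefficient lists, lowest degree first
  Poly : Set
  Poly = List Carrier

  _+ₚ_ : Poly → Poly → Poly
  [] +ₚ b = b
  (x ∷ a) +ₚ [] = x ∷ a
  (x ∷ a) +ₚ (y ∷ b) = (x + y) ∷ (a +ₚ b)

  -ₚ_ : Poly → Poly
  -ₚ a = map -_ a

  _-ₚ_ : Poly → Poly → Poly
  a -ₚ b = a +ₚ (-ₚ b)

  _*ₚ_ : Poly → Poly → Poly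
  [] *ₚ b = []
  (x ∷ a) *ₚ b = map (x *_) b +ₚ (0# ∷ (a *ₚ b))

  1ₚ : Poly
  1ₚ = [ 1# ]

  Tₚ : Poly
  Tₚ = 0# ∷ 1# ∷ []

  -- equality of polynomials (ignoring trailing zero coefficients)
  _≈ₚ_ : Poly → Poly → Set
  a ≈ₚ b = All (_≈ 0#) (a -ₚ b)

  Monic : Poly → Set
  Monic p = Σ Poly λ cs → Σ Carrier λ c → p ≡ cs ++ [ c ] × c ≈ 1#

  UnitA : Poly → Set
  UnitA a = ∃ λ b → (a *ₚ b) ≈ₚ 1ₚ

  Irreducible : Poly → Set
  Irreducible p = ¬ (p ≈ₚ []) × ¬ UnitA p ×
    (∀ a b → p ≈ₚ (a *ₚ b) → UnitA a ⊎ UnitA b)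

  -- F_p = A / pA, as a setoid on A (elements = polynomials, equality mod p)
  module Fp (q : ℕ) (p : Poly) where

    _≡ₘ_ : Poly → Poly → Set
    a ≡ₘ b = ∃ λ c → (a -ₚ b) ≈ₚ (c *ₚ p)

    T̂ : Poly
    T̂ = Tₚ

    powₚ : Poly → ℕ → Poly
    powₚ a zero = 1ₚ
    powₚ a (suc n) = a *ₚ powₚ a n

    frob : Poly → Poly
    frob a = powₚ a q

    -- twisted polynomial ring F_p{τ}: lists of coefficients (τ^0 first)
    TPoly : Set
    TPoly = List Poly

    _+τ_ : TPoly → TPoly → TPoly
    [] +τ b = b
    (x ∷ a) +τ [] = x ∷ a
    (x ∷ a) +τ (y ∷ b) = (x +ₚ y) ∷ (a +τ b)

    -τ_ : TPoly → TPoly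
    -τ a = map -ₚ_ a

    -- left multiplication by τ :  τ (Σ c_j τ^j) = Σ c_j^q τ^(j+1)
    τ· : TPoly → TPoly
    τ· c = [] ∷ map frob c

    -- (a + τ A') B = a B + τ (A' B)
    _*τ_ : TPoly → TPoly → TPoly
    [] *τ b = []
    (x ∷ a) *τ b = map (x *ₚ_) b +τ τ· (a *τ b)

    _≈τ_ : TPoly → TPoly → Set
    a ≈τ b = All (_≡ₘ []) (a +τ (-τ b))

    φT : Poly → Poly → TPoly
    φT γ δ = T̂ ∷ γ ∷ δ ∷ []

    -- F_p-isomorphism of Drinfeld modules (given by their T-images)
    Isomorphic : TPoly → TPoly → Set
    Isomorphic φ ψ = Σ Poly λ μ → ¬ (μ ≡ₘ []) × ([ μ ] *τ φ) ≈τ (ψ *τ [ μ ])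

    DistinctClasses : List Poly → Set
    DistinctClasses ds =
      All (λ δ → ¬ (δ ≡ₘ [])) ds ×
      AllPairs (λ δ δ' → ¬ Isomorphic (φT [] δ) (φT [] δ')) ds

{-# OPTIONS --safe #-}
-- Over the residue field F_p = F_q[T]/(p), which is a field because p is irreducible,
-- φ(0,δ) and φ(0,δ′) are isomorphic as soon as some μ ≠ 0 satisfies the τ²-coefficient
-- equation μδ = (δ′μ)^(q²) of μφ_T = ψ_Tμ; the lower coefficients agree for every μ.
-- Such a μ exists whenever δ and δ′ lie in the same coset of the subgroup H of
-- (q² − 1)-th powers in F_p^*. Hence pairwise non-isomorphic φ(0,δ) lie in distinct
-- cosets of H, and there are at most [F_p^* : H] ≤ q² − 1 of them, because every fibre
-- of x ↦ x^(q²−1) consists of roots of a polynomial of degree q² − 1. So C = 1 works.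
module Submission where

open import Level using (0ℓ; _⊔_)
open import Algebra.Bundles using (CommutativeRing)
open import Algebra.Structures using (IsCommutativeRing)
open import Data.Fin as Fin using (Fin)
open import Data.Nat as ℕ using (ℕ; zero; suc; _≤_; _<_; z≤n; s≤s)
import Data.Nat.Properties as ℕ
open import Data.Nat.Primality using (Prime; ¬prime[0]; ¬prime[1])
open import Data.List
  using (List; []; _∷_; _++_; [_]; map; concat; filter; deduplicate; replicate; tabulate; cartesianProductWith; length)
open import Data.List.Properties using (length-++; length-map; length-removeAt′; length-replicate; map-++)
open import Data.List.Relation.Unary.All as All using (All; []; _∷_)
import Data.List.Relation.Unary.All.Properties as All
open import Data.List.Relation.Unary.Any as Any using (Any; here; there; index)
import Data.List.Relation.Unary.Any.Properties as Any
open import Data.List.Relation.Unary.AllPairs as AllPairs using (AllPairs; []; _∷_)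
import Data.List.Relation.Unary.AllPairs.Properties as AllPairs
import Data.List.Relation.Unary.Unique.Setoid.Properties as Unique
import Data.List.Relation.Unary.Unique.DecSetoid.Properties as Unique
open import Data.List.Relation.Unary.Enumerates.Setoid using (IsEnumeration)
open import Data.List.Membership.Setoid.Properties
  using ( ∈-filter⁺; ∈-deduplicate⁺; ∈-map⁺; ∈-concat⁺; ∈-concat⁻; ∈-length; ∈-tabulate⁺; ∈-resp-≈
        ; ∈-cartesianProductWith⁺)
open import Data.Product using (Σ; ∃; ∃₂; _×_; _,_; proj₁; proj₂)
open import Data.Sum using (_⊎_; inj₁; inj₂)
open import Relation.Binary.Bundles using (Setoid; DecSetoid)
open import Relation.Binary.Core using (Rel)
open import Relation.Binary.Definitions using (Decidable)
open import Relation.Unary using () renaming (Decidable to Decidable₁)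
open import Relation.Nullary using (¬_; yes; no; contradiction)
open import Relation.Nullary.Decidable using (¬?)
open import Relation.Binary.PropositionalEquality as ≡ using (_≡_)
open import Defs

module _ {c ℓ} (S : Setoid c ℓ) where
  open Setoid S
  open import Data.List.Membership.Setoid S using (_∈_; _─_)
  open import Data.List.Relation.Binary.Subset.Setoid S using (_⊆_)
  open import Data.List.Relation.Unary.Unique.Setoid S using (Unique)

  ∈-─ : ∀ {x y ys} (x∈ys : x ∈ ys) → y ∈ ys → x ≉ y → y ∈ ys ─ x∈ys
  ∈-─ (here x≈z) (here y≈z) x≉y = contradiction (trans x≈z (sym y≈z)) x≉y
  ∈-─ (here _)   (there y∈ys) _ = y∈ys
  ∈-─ (there _)  (here y≈z) _ = here y≈z
  ∈-─ (there x∈ys) (there y∈ys) x≉y = there (∈-─ x∈ys y∈ys x≉y)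

  unique⊆⇒length≤ : ∀ {xs ys} → Unique xs → xs ⊆ ys → length xs ≤ length ys
  unique⊆⇒length≤ {[]} _ _ = z≤n
  unique⊆⇒length≤ {x ∷ xs} {ys} (x≉xs ∷ xs!) x∷xs⊆ys =
    ℕ.≤-trans (s≤s (unique⊆⇒length≤ xs! xs⊆ys─x))
              (ℕ.≤-reflexive (≡.sym (length-removeAt′ ys (index x∈ys))))
    where
    x∈ys : x ∈ ys
    x∈ys = x∷xs⊆ys (here refl)
    xs⊆ys─x : xs ⊆ ys ─ x∈ys
    xs⊆ys─x y∈xs = ∈-─ x∈ys (x∷xs⊆ys (there y∈xs))
      (All.lookupₛ S (λ y≈z x≉y x≈z → x≉y (trans x≈z (sym y≈z))) x≉xs y∈xs)

module _ {a} {A : Set a} where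

  length-concat-≤ : ∀ {n} (xss : List (List A)) → All (λ xs → length xs ≤ n) xss →
                    length (concat xss) ≤ length xss ℕ.* n
  length-concat-≤ [] [] = z≤n
  length-concat-≤ (xs ∷ xss) (xs≤n ∷ xss≤n) =
    ℕ.≤-trans (ℕ.≤-reflexive (length-++ xs)) (ℕ.+-mono-≤ xs≤n (length-concat-≤ xss xss≤n))

  length-concat-≥ : ∀ {n} (xss : List (List A)) → All (λ xs → n ≤ length xs) xss →
                    length xss ℕ.* n ≤ length (concat xss)
  length-concat-≥ [] [] = z≤n
  length-concat-≥ (xs ∷ xss) (n≤xs ∷ n≤xss) =
    ℕ.≤-trans (ℕ.+-mono-≤ n≤xs (length-concat-≥ xss n≤xss)) (ℕ.≤-reflexive (≡.sym (length-++ xs)))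

  length-++[x] : ∀ (xs : List A) x → length (xs ++ [ x ]) ≡ suc (length xs)
  length-++[x] xs x = ≡.trans (length-++ xs) (ℕ.+-comm (length xs) 1)

  ∷-initLast : ∀ (x : A) xs → ∃₂ λ ys y → x ∷ xs ≡ ys ++ [ y ] × length ys ≡ length xs
  ∷-initLast x []       = [] , x , ≡.refl , ≡.refl
  ∷-initLast x (x′ ∷ xs) with ys , y , x′∷xs≡ys++[y] , |ys|≡|xs| ← ∷-initLast x′ xs =
    x ∷ ys , y , ≡.cong (x ∷_) x′∷xs≡ys++[y] , ≡.cong suc |ys|≡|xs|

  AllPairs-map-All : ∀ {p r s} {P : A → Set p} {R : A → A → Set r} {S : A → A → Set s} →
                     (∀ {x y} → P x → R x y → S x y) → ∀ {xs} → All P xs → AllPairs R xs → AllPairs S xs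
  AllPairs-map-All f []         []         = []
  AllPairs-map-All f (px ∷ pxs) (Rx ∷ Rxs) = All.map (f px) Rx ∷ AllPairs-map-All f pxs Rxs

module RingLemmas {c ℓ} (R : CommutativeRing c ℓ) where
  open CommutativeRing R
  open import Algebra.Properties.Ring ring using (-‿+-comm; -0#≈0#; x[y-z]≈xy-xz; [y-z]x≈yx-zx)
  open import Algebra.Properties.CommutativeSemigroup +-commutativeSemigroup using (interchange)
  open import Relation.Binary.Reasoning.Setoid setoid

  [x+y]-[u+v]≈[x-u]+[y-v] : ∀ x y u v → (x + y) - (u + v) ≈ (x - u) + (y - v)
  [x+y]-[u+v]≈[x-u]+[y-v] x y u v = begin
    (x + y) - (u + v)      ≈⟨ +-congˡ (-‿+-comm u v) ⟨
    (x + y) + (- u + - v)  ≈⟨ interchange x y (- u) (- v) ⟩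
    (x - u) + (y - v)      ∎

  x-0#≈x : ∀ x → x - 0# ≈ x
  x-0#≈x x = trans (+-congˡ -0#≈0#) (+-identityʳ x)

  [x-y]+[y-z]≈x-z : ∀ x y z → (x - y) + (y - z) ≈ x - z
  [x-y]+[y-z]≈x-z x y z = begin
    (x - y) + (y - z)    ≈⟨ +-assoc x (- y) (y - z) ⟩
    x + (- y + (y - z))  ≈⟨ +-congˡ (+-assoc (- y) y (- z)) ⟨
    x + ((- y + y) - z)  ≈⟨ +-congˡ (+-congʳ (-‿inverseˡ y)) ⟩
    x + (0# - z)         ≈⟨ +-congˡ (+-identityˡ (- z)) ⟩
    x - z                ∎

  xy-uv≈x[y-v]+[x-u]v : ∀ x y u v → x * y - u * v ≈ x * (y - v) + (x - u) * v
  xy-uv≈x[y-v]+[x-u]v x y u v = begin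
    x * y - u * v                    ≈⟨ [x-y]+[y-z]≈x-z (x * y) (x * v) (u * v) ⟨
    (x * y - x * v) + (x * v - u * v) ≈⟨ +-cong (x[y-z]≈xy-xz x y v) ([y-z]x≈yx-zx v x u) ⟨
    x * (y - v) + (x - u) * v        ∎

  a≈qb+r∧g≈sb+tr⇒g≈ta+[s-tq]b : ∀ {a b q r g s t} → a ≈ q * b + r → g ≈ s * b + t * r →
                                g ≈ t * a + (s - t * q) * b
  a≈qb+r∧g≈sb+tr⇒g≈ta+[s-tq]b {a} {b} {q} {r} {g} {s} {t} a≈qb+r g≈sb+tr = sym (begin
    t * a + (s - t * q) * b                    ≈⟨ +-cong (*-congˡ a≈qb+r) ([y-z]x≈yx-zx b s (t * q)) ⟩
    t * (q * b + r) + (s * b - t * q * b)      ≈⟨ +-congʳ (trans (distribˡ t (q * b) r) (+-comm _ _)) ⟩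
    (t * r + t * (q * b)) + (s * b - t * q * b) ≈⟨ +-congʳ (+-congˡ (*-assoc t q b)) ⟨
    (t * r + t * q * b) + (s * b - t * q * b)  ≈⟨ interchange (t * r) (t * q * b) (s * b) (- (t * q * b)) ⟩
    (t * r + s * b) + (t * q * b - t * q * b)  ≈⟨ +-cong (+-comm (t * r) (s * b)) (-‿inverseʳ (t * q * b)) ⟩
    (s * b + t * r) + 0#                       ≈⟨ +-identityʳ _ ⟩
    s * b + t * r                              ≈⟨ g≈sb+tr ⟨
    g                                          ∎)

module RingDivisibility {c ℓ} (R : CommutativeRing c ℓ) where
  open CommutativeRing R
  open import Algebra.Properties.Semiring.Divisibility semiring public
    using (_∣_; _,_; _∣0; ∣ʳ-refl; ∣ʳ-trans; ∣ʳ-respʳ-≈; x∣ʳy⇒x∣ʳzy)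
  open import Algebra.Properties.Ring ring using (-‿distribˡ-*)

  x∣y∧x∣z⇒x∣y+z : ∀ {x y z} → x ∣ y → x ∣ z → x ∣ y + z
  x∣y∧x∣z⇒x∣y+z {x} (q , qx≈y) (r , rx≈z) = q + r , trans (distribʳ x q r) (+-cong qx≈y rx≈z)

  x∣y⇒x∣-y : ∀ {x y} → x ∣ y → x ∣ - y
  x∣y⇒x∣-y {x} (q , qx≈y) = - q , trans (sym (-‿distribˡ-* q x)) (-‿cong qx≈y)

  x∣y⇒x∣yz : ∀ {x y} z → x ∣ y → x ∣ y * z
  x∣y⇒x∣yz {y = y} z x∣y = ∣ʳ-respʳ-≈ (*-comm z y) (x∣ʳy⇒x∣ʳzy z x∣y)

module FieldProperties (K : CommutativeRing 0ℓ 0ℓ) (isField : IsField K) where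
  open CommutativeRing K
  open RingLemmas K
  open import Algebra.Properties.Ring ring using (x∙y⁻¹≈ε⇒x≈y; -‿+-comm)
  open import Algebra.Properties.Semiring.Exp semiring using (_^_; ^-congˡ)
  open import Algebra.Properties.CommutativeSemiring.Exp commutativeSemiring using (^-distrib-*)
  open import Relation.Binary.Reasoning.Setoid setoid

  1≉0 : 1# ≉ 0#
  1≉0 = proj₁ isField

  inverse : ∀ x → x ≉ 0# → ∃ λ y → x * y ≈ 1#
  inverse = proj₂ isField

  *-cancelˡ : ∀ {a x y} → a ≉ 0# → a * x ≈ a * y → x ≈ y
  *-cancelˡ {a} {x} {y} a≉0 ax≈ay with inverse a a≉0
  ... | a⁻¹ , aa⁻¹≈1 = begin
    x               ≈⟨ *-identityˡ x ⟨
    1# * x          ≈⟨ *-congʳ aa⁻¹≈1 ⟨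
    (a * a⁻¹) * x   ≈⟨ *-congʳ (*-comm a a⁻¹) ⟩
    (a⁻¹ * a) * x   ≈⟨ *-assoc a⁻¹ a x ⟩
    a⁻¹ * (a * x)   ≈⟨ *-congˡ ax≈ay ⟩
    a⁻¹ * (a * y)   ≈⟨ *-assoc a⁻¹ a y ⟨
    (a⁻¹ * a) * y   ≈⟨ *-congʳ (*-comm a⁻¹ a) ⟩
    (a * a⁻¹) * y   ≈⟨ *-congʳ aa⁻¹≈1 ⟩
    1# * y          ≈⟨ *-identityˡ y ⟩
    y               ∎

  *-nonzero : ∀ {a b} → a ≉ 0# → b ≉ 0# → a * b ≉ 0#
  *-nonzero {a} a≉0 b≉0 ab≈0 = b≉0 (*-cancelˡ a≉0 (trans ab≈0 (sym (zeroʳ a))))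

  inverse-nonzero : ∀ {x y} → x * y ≈ 1# → y ≉ 0#
  inverse-nonzero {x} {y} xy≈1 y≈0 = 1≉0 (trans (sym xy≈1) (trans (*-congˡ y≈0) (zeroʳ x)))

  ^-nonzero : ∀ {x} n → x ≉ 0# → x ^ n ≉ 0#
  ^-nonzero zero    _   = 1≉0
  ^-nonzero (suc n) x≉0 = *-nonzero x≉0 (^-nonzero n x≉0)

  1^n≈1 : ∀ n → 1# ^ n ≈ 1#
  1^n≈1 zero    = refl
  1^n≈1 (suc n) = trans (*-identityˡ _) (1^n≈1 n)

  data Degree : ℕ → (Carrier → Carrier) → Set where
    constant : ∀ {f} c → c ≉ 0# → (∀ x → f x ≈ c) → Degree 0 f
    horner   : ∀ {m f g} c → Degree m g → (∀ x → f x ≈ c + x * g x) → Degree (suc m) f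

  horner-difference : ∀ {f g : Carrier → Carrier} {c} → (∀ x → f x ≈ c + x * g x) →
                      ∀ x r → f x - f r ≈ x * (g x - g r) + (x - r) * g r
  horner-difference {f} {g} {c} f≈ x r = begin
    f x - f r                          ≈⟨ +-cong (f≈ x) (-‿cong (f≈ r)) ⟩
    (c + x * g x) - (c + r * g r)      ≈⟨ [x+y]-[u+v]≈[x-u]+[y-v] c (x * g x) c (r * g r) ⟩
    (c - c) + (x * g x - r * g r)      ≈⟨ +-congʳ (-‿inverseʳ c) ⟩
    0# + (x * g x - r * g r)           ≈⟨ +-identityˡ _ ⟩
    x * g x - r * g r                  ≈⟨ xy-uv≈x[y-v]+[x-u]v x (g x) r (g r) ⟩
    x * (g x - g r) + (x - r) * g r    ∎

  remainder-theorem : ∀ {m f} → Degree (suc m) f → ∀ r →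
                      ∃ λ h → Degree m h × (∀ x → f x - f r ≈ (x - r) * h x)
  remainder-theorem {f = f} (horner {g = g} c (constant d d≉0 g≈d) f≈) r =
    (λ _ → g r) , constant (g r) (λ gr≈0 → d≉0 (trans (sym (g≈d r)) gr≈0)) (λ _ → refl) , λ x → begin
      f x - f r                        ≈⟨ horner-difference f≈ x r ⟩
      x * (g x - g r) + (x - r) * g r  ≈⟨ +-congʳ (*-congˡ (trans (+-cong (g≈d x) (-‿cong (g≈d r))) (-‿inverseʳ d))) ⟩
      x * 0# + (x - r) * g r           ≈⟨ +-congʳ (zeroʳ x) ⟩
      0# + (x - r) * g r               ≈⟨ +-identityˡ _ ⟩
      (x - r) * g r                    ∎
  remainder-theorem {f = f} (horner {g = g} c g-deg@(horner _ _ _) f≈) r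
    with k , k-deg , g-diff ← remainder-theorem g-deg r =
    (λ x → g r + x * k x) , horner (g r) k-deg (λ _ → refl) , λ x → begin
      f x - f r                                ≈⟨ horner-difference f≈ x r ⟩
      x * (g x - g r) + (x - r) * g r          ≈⟨ +-congʳ (*-congˡ (g-diff x)) ⟩
      x * ((x - r) * k x) + (x - r) * g r      ≈⟨ +-congʳ (x∙yz≈y∙xz x (x - r) (k x)) ⟩
      (x - r) * (x * k x) + (x - r) * g r      ≈⟨ distribˡ (x - r) (x * k x) (g r) ⟨
      (x - r) * (x * k x + g r)                ≈⟨ *-congˡ (+-comm (x * k x) (g r)) ⟩
      (x - r) * (g r + x * k x)                ∎
    where open import Algebra.Properties.CommutativeSemigroup *-commutativeSemigroup using (x∙yz≈y∙xz)

  open import Data.List.Relation.Unary.Unique.Setoid setoid using (Unique)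

  roots-length≤ : ∀ {m f rs} → Degree m f → Unique rs → All (λ r → f r ≈ 0#) rs → length rs ≤ m
  roots-length≤ {rs = []} _ _ _ = z≤n
  roots-length≤ {rs = r ∷ _} (constant c c≉0 f≈c) _ (fr≈0 ∷ _) =
    contradiction (trans (sym (f≈c r)) fr≈0) c≉0
  roots-length≤ {f = f} {rs = r ∷ rs} f-deg@(horner _ _ _) (r≉rs ∷ rs!) (fr≈0 ∷ frs≈0)
    with h , h-deg , f-diff ← remainder-theorem f-deg r =
    s≤s (roots-length≤ h-deg rs! (All.zipWith h≈0 (r≉rs , frs≈0)))
    where
    h≈0 : ∀ {x} → r ≉ x × f x ≈ 0# → h x ≈ 0#
    h≈0 {x} (r≉x , fx≈0) = *-cancelˡ x-r≉0 (begin
      (x - r) * h x  ≈⟨ f-diff x ⟨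
      f x - f r      ≈⟨ +-cong fx≈0 (-‿cong fr≈0) ⟩
      0# - 0#        ≈⟨ -‿inverseʳ 0# ⟩
      0#             ≈⟨ zeroʳ (x - r) ⟨
      (x - r) * 0#   ∎)
      where
      x-r≉0 : x - r ≉ 0#
      x-r≉0 x-r≈0 = r≉x (sym (x∙y⁻¹≈ε⇒x≈y x r x-r≈0))

  x^n-degree : ∀ n → Degree n (_^ n)
  x^n-degree zero    = constant 1# 1≉0 (λ _ → refl)
  x^n-degree (suc n) = horner 0# (x^n-degree n) (λ x → sym (+-identityˡ (x * x ^ n)))

  nthRoots-length≤ : ∀ n y {xs} → Unique xs → All (λ x → x ^ suc n ≈ y) xs → length xs ≤ suc n
  nthRoots-length≤ n y xs! xs^n≈y = roots-length≤ x^[1+n]-y-degree xs!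
    (All.map (λ x^n≈y → trans (+-congʳ x^n≈y) (-‿inverseʳ y)) xs^n≈y)
    where
    x^[1+n]-y-degree : Degree (suc n) (λ x → x ^ suc n - y)
    x^[1+n]-y-degree = horner (- y) (x^n-degree n) (λ x → +-comm (x * x ^ n) (- y))

  SameCoset : ℕ → Carrier → Carrier → Set
  SameCoset m δ δ′ = ∃₂ λ α β → α ≉ 0# × β ≉ 0# × δ * α ^ m ≈ δ′ * β ^ m

  sameCoset⇒≉0 : ∀ {m δ δ′} → δ ≉ 0# → SameCoset m δ δ′ → δ′ ≉ 0#
  sameCoset⇒≉0 {m} δ≉0 (α , β , α≉0 , _ , δα^m≈δ′β^m) δ′≈0 = *-nonzero δ≉0 (^-nonzero m α≉0)
    (trans δα^m≈δ′β^m (trans (*-congʳ δ′≈0) (zeroˡ (β ^ m))))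

  sameCoset⇒μδ≈[δ′μ]^[1+m] : ∀ {m δ δ′} → δ ≉ 0# → SameCoset m δ δ′ →
                             ∃ λ μ → μ ≉ 0# × μ * δ ≈ (δ′ * μ) ^ suc m
  sameCoset⇒μδ≈[δ′μ]^[1+m] {m} {δ} {δ′} δ≉0 δ~δ′@(α , β , α≉0 , β≉0 , δα^m≈δ′β^m)
    with u , αu≈1 ← inverse α α≉0 | v , δ′v≈1 ← inverse δ′ (sameCoset⇒≉0 {m} δ≉0 δ~δ′) =
    μ , *-nonzero (inverse-nonzero δ′v≈1) (*-nonzero β≉0 (inverse-nonzero αu≈1)) , (begin
      μ * δ              ≈⟨ *-congˡ δ≈δ′γ^m ⟩
      μ * (δ′ * γ ^ m)   ≈⟨ *-assoc μ δ′ (γ ^ m) ⟨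
      (μ * δ′) * γ ^ m   ≈⟨ *-congʳ (trans (*-comm μ δ′) δ′μ≈γ) ⟩
      γ * γ ^ m          ≈⟨ ^-congˡ (suc m) δ′μ≈γ ⟨
      (δ′ * μ) ^ suc m   ∎)
    where
    γ μ : Carrier
    γ = β * u
    μ = v * γ
    δ′μ≈γ : δ′ * μ ≈ γ
    δ′μ≈γ = trans (sym (*-assoc δ′ v γ)) (trans (*-congʳ δ′v≈1) (*-identityˡ γ))
    δ≈δ′γ^m : δ ≈ δ′ * γ ^ m
    δ≈δ′γ^m = begin
      δ                        ≈⟨ *-identityʳ δ ⟨
      δ * 1#                   ≈⟨ *-congˡ (trans (^-congˡ m αu≈1) (1^n≈1 m)) ⟨
      δ * (α * u) ^ m          ≈⟨ *-congˡ (^-distrib-* α u m) ⟩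
      δ * (α ^ m * u ^ m)      ≈⟨ *-assoc δ (α ^ m) (u ^ m) ⟨
      (δ * α ^ m) * u ^ m      ≈⟨ *-congʳ δα^m≈δ′β^m ⟩
      (δ′ * β ^ m) * u ^ m     ≈⟨ *-assoc δ′ (β ^ m) (u ^ m) ⟩
      δ′ * (β ^ m * u ^ m)     ≈⟨ *-congˡ (^-distrib-* β u m) ⟨
      δ′ * γ ^ m               ∎

module FiniteFieldCosets (K : CommutativeRing 0ℓ 0ℓ) (isField : IsField K)
  (_≟_ : Decidable (CommutativeRing._≈_ K))
  {elements : List (CommutativeRing.Carrier K)} (enumerates : IsEnumeration (CommutativeRing.setoid K) elements) where
  open CommutativeRing K
  open FieldProperties K isField
  open import Algebra.Properties.Semiring.Exp semiring using (_^_; ^-congˡ)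
  open import Data.List.Relation.Unary.Unique.Setoid setoid using (Unique)
  open import Data.List.Membership.Setoid setoid using (_∈_)
  open import Data.List.Relation.Binary.Subset.Setoid setoid using (_⊆_)
  open import Data.List.Relation.Binary.Disjoint.Setoid setoid using (Disjoint)

  decSetoid : DecSetoid 0ℓ 0ℓ
  decSetoid = record { isDecEquivalence = record { isEquivalence = isEquivalence ; _≟_ = _≟_ } }

  nonzero? : Decidable₁ (_≉ 0#)
  nonzero? x = ¬? (x ≟ 0#)

  units : List Carrier
  units = deduplicate _≟_ (filter nonzero? elements)

  units-unique : Unique units
  units-unique = Unique.deduplicate-! decSetoid (filter nonzero? elements)

  units-nonzero : All (_≉ 0#) units
  units-nonzero = All.deduplicate⁺ _≟_ (All.all-filter nonzero? elements)

  ∈-units : ∀ {x} → x ≉ 0# → x ∈ units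
  ∈-units x≉0 = ∈-deduplicate⁺ setoid _≟_ (λ z≈y x≈y → trans x≈y (sym z≈y))
    (∈-filter⁺ setoid nonzero? (λ x≈y x≉0 y≈0 → x≉0 (trans x≈y y≈0)) (enumerates _) x≉0)

  module _ (n : ℕ) where
    powers : List Carrier
    powers = deduplicate _≟_ (map (_^ suc n) units)

    powers-unique : Unique powers
    powers-unique = Unique.deduplicate-! decSetoid (map (_^ suc n) units)

    powers-are-powers : All (λ h → ∃ λ α → α ≉ 0# × h ≈ α ^ suc n) powers
    powers-are-powers = All.deduplicate⁺ _≟_ (All.map⁺ (All.map (λ α≉0 → _ , α≉0 , refl) units-nonzero))

    ∈-powers : ∀ {α} → α ≉ 0# → α ^ suc n ∈ powers
    ∈-powers α≉0 = ∈-deduplicate⁺ setoid _≟_ (λ z≈y x≈y → trans x≈y (sym z≈y))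
      (∈-map⁺ setoid setoid (^-congˡ (suc n)) (∈-units α≉0))

    fibre : Carrier → List Carrier
    fibre y = filter (λ x → (x ^ suc n) ≟ y) units

    units⊆fibres : units ⊆ concat (map fibre powers)
    units⊆fibres {x} x∈units = ∈-concat⁺ setoid (Any.map⁺ (Any.map x∈fibre (∈-powers x≉0)))
      where
      x≉0 : x ≉ 0#
      x≉0 = All.lookupₛ setoid (λ x≈y x≉0 y≈0 → x≉0 (trans x≈y y≈0)) units-nonzero x∈units
      x∈fibre : ∀ {y} → x ^ suc n ≈ y → x ∈ fibre y
      x∈fibre x^n≈y = ∈-filter⁺ setoid (λ x → (x ^ suc n) ≟ _)
        (λ x≈z x^n≈y → trans (^-congˡ (suc n) (sym x≈z)) x^n≈y) x∈units x^n≈y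

    fibre-length≤ : ∀ y → length (fibre y) ≤ suc n
    fibre-length≤ y = nthRoots-length≤ n y (Unique.filter⁺ setoid _ units-unique) (All.all-filter _ units)

    units-length≤ : length units ≤ length powers ℕ.* suc n
    units-length≤ = begin
      length units
        ≤⟨ unique⊆⇒length≤ setoid units-unique units⊆fibres ⟩
      length (concat (map fibre powers))
        ≤⟨ length-concat-≤ (map fibre powers) (All.map⁺ (All.universal fibre-length≤ powers)) ⟩
      length (map fibre powers) ℕ.* suc n
        ≡⟨ ≡.cong (ℕ._* suc n) (length-map fibre powers) ⟩
      length powers ℕ.* suc n
        ∎
      where open ℕ.≤-Reasoning

    coset : Carrier → List Carrier
    coset δ = map (δ *_) powers

    ∈-coset⁻ : ∀ {v δ} → v ∈ coset δ → ∃ λ α → α ≉ 0# × v ≈ δ * α ^ suc n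
    ∈-coset⁻ v∈δH with (α , α≉0 , h≈α^n) , v≈δh ← All.lookupAny powers-are-powers (Any.map⁻ v∈δH) =
      α , α≉0 , trans v≈δh (*-congˡ h≈α^n)

    coset-unique : ∀ {δ} → δ ≉ 0# → Unique (coset δ)
    coset-unique δ≉0 = Unique.map⁺ setoid setoid (*-cancelˡ δ≉0) powers-unique

    coset⊆units : ∀ {δ} → δ ≉ 0# → coset δ ⊆ units
    coset⊆units δ≉0 v∈δH with α , α≉0 , v≈δα^n ← ∈-coset⁻ v∈δH =
      ∈-units (λ v≈0 → *-nonzero δ≉0 (^-nonzero (suc n) α≉0) (trans (sym v≈δα^n) v≈0))

    cosets-disjoint : ∀ {δ δ′} → ¬ SameCoset (suc n) δ δ′ → Disjoint (coset δ) (coset δ′)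
    cosets-disjoint ¬δ~δ′ (v∈δH , v∈δ′H)
      with α , α≉0 , v≈δα^n ← ∈-coset⁻ v∈δH | β , β≉0 , v≈δ′β^n ← ∈-coset⁻ v∈δ′H =
      ¬δ~δ′ (α , β , α≉0 , β≉0 , trans (sym v≈δα^n) v≈δ′β^n)

  sameCosetClasses-length≤ : ∀ n {ds} → All (_≉ 0#) ds → AllPairs (λ δ δ′ → ¬ SameCoset (suc n) δ δ′) ds →
                             length ds ≤ suc n
  sameCosetClasses-length≤ n {ds} ds≉0 ds-apart =
    ℕ.*-cancelʳ-≤ (length ds) (suc n) (length (powers n)) {{ℕ.>-nonZero (∈-length setoid (∈-powers n 1≉0))}} (begin
      length ds ℕ.* length (powers n)
        ≡⟨ ≡.cong (ℕ._* length (powers n)) (length-map (coset n) ds) ⟨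
      length cosets ℕ.* length (powers n)
        ≤⟨ length-concat-≥ cosets (All.map⁺ (All.universal (λ δ → ℕ.≤-reflexive (≡.sym (length-map (δ *_) (powers n)))) ds)) ⟩
      length (concat cosets)
        ≤⟨ unique⊆⇒length≤ setoid cosets-unique cosets⊆units ⟩
      length units
        ≤⟨ units-length≤ n ⟩
      length (powers n) ℕ.* suc n
        ≡⟨ ℕ.*-comm (length (powers n)) (suc n) ⟩
      suc n ℕ.* length (powers n)
        ∎)
    where
    open ℕ.≤-Reasoning
    cosets : List (List Carrier)
    cosets = map (coset n) ds
    cosets-unique : Unique (concat cosets)
    cosets-unique = Unique.concat⁺ setoid (All.map⁺ (All.map (coset-unique n) ds≉0))
                                          (AllPairs.map⁺ (AllPairs.map (cosets-disjoint n) ds-apart))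
    cosets⊆units : concat cosets ⊆ units
    cosets⊆units v∈cosets with δ≉0 , v∈δH ← All.lookupAny ds≉0 (Any.map⁻ (∈-concat⁻ setoid cosets v∈cosets)) =
      coset⊆units n δ≉0 v∈δH

module Polynomials (F : CommutativeRing 0ℓ 0ℓ) where
  open CommutativeRing F
  open import Algebra.Properties.Ring ring using (-0#≈0#)
  open import Algebra.Properties.CommutativeSemigroup +-commutativeSemigroup using (interchange; x∙yz≈y∙xz)
  open import Relation.Binary.Reasoning.Setoid setoid

  A : Set
  A = Poly F

  infixl 6 _⊕_
  infixl 7 _⊗_ _·_
  infix 8 ⊖_

  _⊕_ : A → A → A
  _⊕_ = _+ₚ_ F

  _⊗_ : A → A → A
  _⊗_ = _*ₚ_ F

  ⊖_ : A → A
  ⊖_ = -ₚ_ F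

  _·_ : Carrier → A → A
  x · a = map (x *_) a

  coeff : A → ℕ → Carrier
  coeff []      _       = 0#
  coeff (x ∷ _) zero    = x
  coeff (_ ∷ a) (suc n) = coeff a n

  infix 4 _≋_
  record _≋_ (a b : A) : Set where
    constructor coeffwise
    field coeff-≈ : ∀ n → coeff a n ≈ coeff b n
  open _≋_ public

  ≋-refl : ∀ {a} → a ≋ a
  ≋-refl = coeffwise λ _ → refl

  ≋-sym : ∀ {a b} → a ≋ b → b ≋ a
  ≋-sym a≋b = coeffwise λ n → sym (coeff-≈ a≋b n)

  ≋-trans : ∀ {a b c} → a ≋ b → b ≋ c → a ≋ c
  ≋-trans a≋b b≋c = coeffwise λ n → trans (coeff-≈ a≋b n) (coeff-≈ b≋c n)

  ∷-cong : ∀ {x y a b} → x ≈ y → a ≋ b → (x ∷ a) ≋ (y ∷ b)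
  ∷-cong x≈y a≋b = coeffwise λ { zero → x≈y ; (suc n) → coeff-≈ a≋b n }

  ∷-injectiveʳ : ∀ {x y a b} → (x ∷ a) ≋ (y ∷ b) → a ≋ b
  ∷-injectiveʳ x∷a≋y∷b = coeffwise λ n → coeff-≈ x∷a≋y∷b (suc n)

  ∷≋[]⇒≋[] : ∀ {x a} → (x ∷ a) ≋ [] → a ≋ []
  ∷≋[]⇒≋[] x∷a≋0 = coeffwise λ n → coeff-≈ x∷a≋0 (suc n)

  coeff-⊕ : ∀ a b n → coeff (a ⊕ b) n ≈ coeff a n + coeff b n
  coeff-⊕ []      b       n       = sym (+-identityˡ _)
  coeff-⊕ (x ∷ a) []      n       = sym (+-identityʳ _)
  coeff-⊕ (x ∷ a) (y ∷ b) zero    = refl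
  coeff-⊕ (x ∷ a) (y ∷ b) (suc n) = coeff-⊕ a b n

  coeff-⊖ : ∀ a n → coeff (⊖ a) n ≈ - coeff a n
  coeff-⊖ []      n       = sym -0#≈0#
  coeff-⊖ (x ∷ a) zero    = refl
  coeff-⊖ (x ∷ a) (suc n) = coeff-⊖ a n

  coeff-· : ∀ x a n → coeff (x · a) n ≈ x * coeff a n
  coeff-· x []      n       = sym (zeroʳ x)
  coeff-· x (y ∷ a) zero    = refl
  coeff-· x (y ∷ a) (suc n) = coeff-· x a n

  coeff-0∷ : ∀ n → coeff (0# ∷ []) n ≈ 0#
  coeff-0∷ zero    = refl
  coeff-0∷ (suc n) = refl

  coeff-0∷-⊕ : ∀ u v n → coeff (0# ∷ (u ⊕ v)) n ≈ coeff (0# ∷ u) n + coeff (0# ∷ v) n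
  coeff-0∷-⊕ u v zero    = sym (+-identityˡ 0#)
  coeff-0∷-⊕ u v (suc n) = coeff-⊕ u v n

  coeff-0∷-· : ∀ x u n → coeff (0# ∷ (x · u)) n ≈ x * coeff (0# ∷ u) n
  coeff-0∷-· x u zero    = sym (zeroʳ x)
  coeff-0∷-· x u (suc n) = coeff-· x u n

  coeff-⊗ : ∀ x a b n → coeff ((x ∷ a) ⊗ b) n ≈ x * coeff b n + coeff (0# ∷ (a ⊗ b)) n
  coeff-⊗ x a b n = trans (coeff-⊕ (x · b) (0# ∷ (a ⊗ b)) n) (+-congʳ (coeff-· x b n))

  ⊕-cong : ∀ {a a′ b b′} → a ≋ a′ → b ≋ b′ → a ⊕ b ≋ a′ ⊕ b′
  ⊕-cong {a} {a′} {b} {b′} a≋a′ b≋b′ = coeffwise λ n → begin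
    coeff (a ⊕ b) n             ≈⟨ coeff-⊕ a b n ⟩
    coeff a n + coeff b n       ≈⟨ +-cong (coeff-≈ a≋a′ n) (coeff-≈ b≋b′ n) ⟩
    coeff a′ n + coeff b′ n     ≈⟨ coeff-⊕ a′ b′ n ⟨
    coeff (a′ ⊕ b′) n           ∎

  ⊕-comm : ∀ a b → a ⊕ b ≋ b ⊕ a
  ⊕-comm a b = coeffwise λ n → trans (coeff-⊕ a b n) (trans (+-comm _ _) (sym (coeff-⊕ b a n)))

  ⊕-assoc : ∀ a b c → (a ⊕ b) ⊕ c ≋ a ⊕ (b ⊕ c)
  ⊕-assoc a b c = coeffwise λ n → begin
    coeff ((a ⊕ b) ⊕ c) n                ≈⟨ trans (coeff-⊕ (a ⊕ b) c n) (+-congʳ (coeff-⊕ a b n)) ⟩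
    (coeff a n + coeff b n) + coeff c n  ≈⟨ +-assoc _ _ _ ⟩
    coeff a n + (coeff b n + coeff c n)  ≈⟨ trans (coeff-⊕ a (b ⊕ c) n) (+-congˡ (coeff-⊕ b c n)) ⟨
    coeff (a ⊕ (b ⊕ c)) n                ∎

  ⊕-identityʳ : ∀ a → a ⊕ [] ≋ a
  ⊕-identityʳ a = coeffwise λ n → trans (coeff-⊕ a [] n) (+-identityʳ _)

  ⊖-cong : ∀ {a b} → a ≋ b → ⊖ a ≋ ⊖ b
  ⊖-cong {a} {b} a≋b = coeffwise λ n → trans (coeff-⊖ a n) (trans (-‿cong (coeff-≈ a≋b n)) (sym (coeff-⊖ b n)))

  ⊖-inverseʳ : ∀ a → a ⊕ ⊖ a ≋ []
  ⊖-inverseʳ a = coeffwise λ n → trans (coeff-⊕ a (⊖ a) n) (trans (+-congˡ (coeff-⊖ a n)) (-‿inverseʳ _))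

  ⊖-inverseˡ : ∀ a → ⊖ a ⊕ a ≋ []
  ⊖-inverseˡ a = ≋-trans (⊕-comm (⊖ a) a) (⊖-inverseʳ a)

  0∷-cong : ∀ {u v} → u ≋ v → (0# ∷ u) ≋ (0# ∷ v)
  0∷-cong = ∷-cong refl

  ⊗-congʳ : ∀ a {b b′} → b ≋ b′ → a ⊗ b ≋ a ⊗ b′
  ⊗-congʳ []      _ = ≋-refl
  ⊗-congʳ (x ∷ a) {b} {b′} b≋b′ = coeffwise λ n → begin
    coeff ((x ∷ a) ⊗ b) n                     ≈⟨ coeff-⊗ x a b n ⟩
    x * coeff b n + coeff (0# ∷ (a ⊗ b)) n
      ≈⟨ +-cong (*-congˡ (coeff-≈ b≋b′ n)) (coeff-≈ (0∷-cong (⊗-congʳ a b≋b′)) n) ⟩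
    x * coeff b′ n + coeff (0# ∷ (a ⊗ b′)) n  ≈⟨ coeff-⊗ x a b′ n ⟨
    coeff ((x ∷ a) ⊗ b′) n                    ∎

  ⊗-zeroˡ : ∀ a b → a ≋ [] → a ⊗ b ≋ []
  ⊗-zeroˡ []      b _    = ≋-refl
  ⊗-zeroˡ (x ∷ a) b x∷a≋0 = coeffwise λ n → begin
    coeff ((x ∷ a) ⊗ b) n                    ≈⟨ coeff-⊗ x a b n ⟩
    x * coeff b n + coeff (0# ∷ (a ⊗ b)) n
      ≈⟨ +-cong (*-congʳ (coeff-≈ x∷a≋0 0)) (coeff-≈ (0∷-cong (⊗-zeroˡ a b (∷≋[]⇒≋[] x∷a≋0))) n) ⟩
    0# * coeff b n + coeff (0# ∷ []) n       ≈⟨ +-cong (zeroˡ _) (coeff-0∷ n) ⟩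
    0# + 0#                                  ≈⟨ +-identityˡ 0# ⟩
    0#                                       ∎

  ⊗-congˡ : ∀ {a a′} b → a ≋ a′ → a ⊗ b ≋ a′ ⊗ b
  ⊗-congˡ {[]}    {a′}     b a≋a′ = ≋-sym (⊗-zeroˡ a′ b (≋-sym a≋a′))
  ⊗-congˡ {x ∷ a} {[]}     b a≋a′ = ⊗-zeroˡ (x ∷ a) b a≋a′
  ⊗-congˡ {x ∷ a} {y ∷ a′} b a≋a′ = coeffwise λ n → begin
    coeff ((x ∷ a) ⊗ b) n                     ≈⟨ coeff-⊗ x a b n ⟩
    x * coeff b n + coeff (0# ∷ (a ⊗ b)) n
      ≈⟨ +-cong (*-congʳ (coeff-≈ a≋a′ 0)) (coeff-≈ (0∷-cong (⊗-congˡ b (∷-injectiveʳ a≋a′))) n) ⟩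
    y * coeff b n + coeff (0# ∷ (a′ ⊗ b)) n   ≈⟨ coeff-⊗ y a′ b n ⟨
    coeff ((y ∷ a′) ⊗ b) n                    ∎

  ⊗-cong : ∀ {a a′ b b′} → a ≋ a′ → b ≋ b′ → a ⊗ b ≋ a′ ⊗ b′
  ⊗-cong {a′ = a′} {b = b} a≋a′ b≋b′ = ≋-trans (⊗-congˡ b a≋a′) (⊗-congʳ a′ b≋b′)

  ⊗-distribʳ : ∀ a a′ b → (a ⊕ a′) ⊗ b ≋ a ⊗ b ⊕ a′ ⊗ b
  ⊗-distribʳ []      a′       b = ≋-refl
  ⊗-distribʳ (x ∷ a) []       b = ≋-sym (⊕-identityʳ ((x ∷ a) ⊗ b))
  ⊗-distribʳ (x ∷ a) (y ∷ a′) b = coeffwise λ n → begin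
    coeff (((x + y) ∷ (a ⊕ a′)) ⊗ b) n
      ≈⟨ coeff-⊗ (x + y) (a ⊕ a′) b n ⟩
    (x + y) * coeff b n + coeff (0# ∷ ((a ⊕ a′) ⊗ b)) n
      ≈⟨ +-cong (distribʳ _ x y) (trans (coeff-≈ (0∷-cong (⊗-distribʳ a a′ b)) n) (coeff-0∷-⊕ (a ⊗ b) (a′ ⊗ b) n)) ⟩
    (x * coeff b n + y * coeff b n) + (coeff (0# ∷ (a ⊗ b)) n + coeff (0# ∷ (a′ ⊗ b)) n)
      ≈⟨ interchange _ _ _ _ ⟩
    (x * coeff b n + coeff (0# ∷ (a ⊗ b)) n) + (y * coeff b n + coeff (0# ∷ (a′ ⊗ b)) n)
      ≈⟨ +-cong (coeff-⊗ x a b n) (coeff-⊗ y a′ b n) ⟨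
    coeff ((x ∷ a) ⊗ b) n + coeff ((y ∷ a′) ⊗ b) n
      ≈⟨ coeff-⊕ ((x ∷ a) ⊗ b) ((y ∷ a′) ⊗ b) n ⟨
    coeff ((x ∷ a) ⊗ b ⊕ (y ∷ a′) ⊗ b) n
      ∎

  ⊗-distribˡ : ∀ a b b′ → a ⊗ (b ⊕ b′) ≋ a ⊗ b ⊕ a ⊗ b′
  ⊗-distribˡ []      b b′ = ≋-refl
  ⊗-distribˡ (x ∷ a) b b′ = coeffwise λ n → begin
    coeff ((x ∷ a) ⊗ (b ⊕ b′)) n
      ≈⟨ coeff-⊗ x a (b ⊕ b′) n ⟩
    x * coeff (b ⊕ b′) n + coeff (0# ∷ (a ⊗ (b ⊕ b′))) n
      ≈⟨ +-cong (trans (*-congˡ (coeff-⊕ b b′ n)) (distribˡ x _ _))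
                (trans (coeff-≈ (0∷-cong (⊗-distribˡ a b b′)) n) (coeff-0∷-⊕ (a ⊗ b) (a ⊗ b′) n)) ⟩
    (x * coeff b n + x * coeff b′ n) + (coeff (0# ∷ (a ⊗ b)) n + coeff (0# ∷ (a ⊗ b′)) n)
      ≈⟨ interchange _ _ _ _ ⟩
    (x * coeff b n + coeff (0# ∷ (a ⊗ b)) n) + (x * coeff b′ n + coeff (0# ∷ (a ⊗ b′)) n)
      ≈⟨ +-cong (coeff-⊗ x a b n) (coeff-⊗ x a b′ n) ⟨
    coeff ((x ∷ a) ⊗ b) n + coeff ((x ∷ a) ⊗ b′) n
      ≈⟨ coeff-⊕ ((x ∷ a) ⊗ b) ((x ∷ a) ⊗ b′) n ⟨
    coeff ((x ∷ a) ⊗ b ⊕ (x ∷ a) ⊗ b′) n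
      ∎

  ·-⊗-assoc : ∀ x a b → x · (a ⊗ b) ≋ (x · a) ⊗ b
  ·-⊗-assoc x []      b = ≋-refl
  ·-⊗-assoc x (y ∷ a) b = coeffwise λ n → begin
    coeff (x · ((y ∷ a) ⊗ b)) n
      ≈⟨ trans (coeff-· x ((y ∷ a) ⊗ b) n) (*-congˡ (coeff-⊗ y a b n)) ⟩
    x * (y * coeff b n + coeff (0# ∷ (a ⊗ b)) n)
      ≈⟨ distribˡ x _ _ ⟩
    x * (y * coeff b n) + x * coeff (0# ∷ (a ⊗ b)) n
      ≈⟨ +-cong (*-assoc x y _) (trans (coeff-≈ (0∷-cong (≋-sym (·-⊗-assoc x a b))) n) (coeff-0∷-· x (a ⊗ b) n)) ⟨
    (x * y) * coeff b n + coeff (0# ∷ ((x · a) ⊗ b)) n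
      ≈⟨ coeff-⊗ (x * y) (x · a) b n ⟨
    coeff ((x · (y ∷ a)) ⊗ b) n
      ∎

  ⊗-assoc : ∀ a b c → (a ⊗ b) ⊗ c ≋ a ⊗ (b ⊗ c)
  ⊗-assoc []      b c = ≋-refl
  ⊗-assoc (x ∷ a) b c = coeffwise λ n → begin
    coeff ((x · b ⊕ (0# ∷ (a ⊗ b))) ⊗ c) n
      ≈⟨ trans (coeff-≈ (⊗-distribʳ (x · b) (0# ∷ (a ⊗ b)) c) n) (coeff-⊕ ((x · b) ⊗ c) ((0# ∷ (a ⊗ b)) ⊗ c) n) ⟩
    coeff ((x · b) ⊗ c) n + coeff ((0# ∷ (a ⊗ b)) ⊗ c) n
      ≈⟨ +-cong (coeff-≈ (≋-sym (·-⊗-assoc x b c)) n) (coeff-⊗ 0# (a ⊗ b) c n) ⟩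
    coeff (x · (b ⊗ c)) n + (0# * coeff c n + coeff (0# ∷ ((a ⊗ b) ⊗ c)) n)
      ≈⟨ +-congˡ (trans (+-cong (zeroˡ _) (coeff-≈ (0∷-cong (⊗-assoc a b c)) n)) (+-identityˡ _)) ⟩
    coeff (x · (b ⊗ c)) n + coeff (0# ∷ (a ⊗ (b ⊗ c))) n
      ≈⟨ coeff-⊕ (x · (b ⊗ c)) (0# ∷ (a ⊗ (b ⊗ c))) n ⟨
    coeff ((x ∷ a) ⊗ (b ⊗ c)) n
      ∎

  ⊗-zeroʳ : ∀ a → a ⊗ [] ≋ []
  ⊗-zeroʳ []      = ≋-refl
  ⊗-zeroʳ (x ∷ a) = coeffwise λ { zero → refl ; (suc n) → coeff-≈ (⊗-zeroʳ a) n }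

  ⊗-∷ʳ : ∀ b x a → b ⊗ (x ∷ a) ≋ x · b ⊕ (0# ∷ (b ⊗ a))
  ⊗-∷ʳ []      x a = coeffwise λ n → sym (coeff-0∷ n)
  ⊗-∷ʳ (y ∷ b) x a = ∷-cong (+-congʳ (*-comm y x)) (coeffwise λ n → begin
    coeff (y · a ⊕ b ⊗ (x ∷ a)) n
      ≈⟨ trans (coeff-⊕ (y · a) (b ⊗ (x ∷ a)) n) (+-cong (coeff-· y a n) (coeff-≈ (⊗-∷ʳ b x a) n)) ⟩
    y * coeff a n + coeff (x · b ⊕ (0# ∷ (b ⊗ a))) n
      ≈⟨ +-congˡ (trans (coeff-⊕ (x · b) (0# ∷ (b ⊗ a)) n) (+-congʳ (coeff-· x b n))) ⟩
    y * coeff a n + (x * coeff b n + coeff (0# ∷ (b ⊗ a)) n)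
      ≈⟨ x∙yz≈y∙xz _ _ _ ⟩
    x * coeff b n + (y * coeff a n + coeff (0# ∷ (b ⊗ a)) n)
      ≈⟨ +-cong (coeff-· x b n) (coeff-⊗ y b a n) ⟨
    coeff (x · b) n + coeff ((y ∷ b) ⊗ a) n
      ≈⟨ coeff-⊕ (x · b) ((y ∷ b) ⊗ a) n ⟨
    coeff (x · b ⊕ (y ∷ b) ⊗ a) n
      ∎)

  ⊗-comm : ∀ a b → a ⊗ b ≋ b ⊗ a
  ⊗-comm []      b = ≋-sym (⊗-zeroʳ b)
  ⊗-comm (x ∷ a) b = ≋-trans (⊕-cong (≋-refl {x · b}) (0∷-cong (⊗-comm a b))) (≋-sym (⊗-∷ʳ b x a))

  ⊗-identityˡ : ∀ b → 1ₚ F ⊗ b ≋ b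
  ⊗-identityˡ b = coeffwise λ n → trans (coeff-⊗ 1# [] b n) (trans (+-cong (*-identityˡ _) (coeff-0∷ n)) (+-identityʳ _))

  ⊗-identityʳ : ∀ b → b ⊗ 1ₚ F ≋ b
  ⊗-identityʳ b = ≋-trans (⊗-comm b (1ₚ F)) (⊗-identityˡ b)

  ≋-isCommutativeRing : IsCommutativeRing _≋_ _⊕_ _⊗_ ⊖_ [] (1ₚ F)
  ≋-isCommutativeRing = record
    { isRing = record
      { +-isAbelianGroup = record
        { isGroup = record
          { isMonoid = record
            { isSemigroup = record
              { isMagma = record
                { isEquivalence = record { refl = ≋-refl ; sym = ≋-sym ; trans = ≋-trans }
                ; ∙-cong = ⊕-cong }
              ; assoc = ⊕-assoc }
            ; identity = (λ _ → ≋-refl) , ⊕-identityʳ }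
          ; inverse = ⊖-inverseˡ , ⊖-inverseʳ
          ; ⁻¹-cong = ⊖-cong }
        ; comm = ⊕-comm }
      ; *-cong = ⊗-cong
      ; *-assoc = ⊗-assoc
      ; *-identity = ⊗-identityˡ , ⊗-identityʳ
      ; distrib = ⊗-distribˡ , (λ b a a′ → ⊗-distribʳ a a′ b) }
    ; *-comm = ⊗-comm }

  -- The ring below uses opaque copies of the operations, so that unifying
  -- ring expressions never unfolds the list recursion of the Defs operations.
  opaque
    _+ᴬ_ _*ᴬ_ : A → A → A
    _+ᴬ_ = _⊕_
    _*ᴬ_ = _⊗_

    -ᴬ_ : A → A
    -ᴬ_ = ⊖_

  opaque
    unfolding _+ᴬ_ _*ᴬ_ -ᴬ_

    +ᴬ≡⊕ : ∀ a b → a +ᴬ b ≡ a ⊕ b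
    +ᴬ≡⊕ _ _ = ≡.refl

    *ᴬ≡⊗ : ∀ a b → a *ᴬ b ≡ a ⊗ b
    *ᴬ≡⊗ _ _ = ≡.refl

    -ᴬ≡⊖ : ∀ a → -ᴬ a ≡ ⊖ a
    -ᴬ≡⊖ _ = ≡.refl

    polyRing-isCommutativeRing : IsCommutativeRing _≋_ _+ᴬ_ _*ᴬ_ -ᴬ_ [] (1ₚ F)
    polyRing-isCommutativeRing = ≋-isCommutativeRing

  polyRing : CommutativeRing 0ℓ 0ℓ
  polyRing = record { isCommutativeRing = polyRing-isCommutativeRing }

  ≈ₚ⇒≋ : ∀ {a b} → _≈ₚ_ F a b → a ≋ b
  ≈ₚ⇒≋ {a} {b} a-b≈0 = coeffwise λ n → x∙y⁻¹≈ε⇒x≈y _ _ (begin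
    coeff a n - coeff b n   ≈⟨ trans (coeff-⊕ a (⊖ b) n) (+-congˡ (coeff-⊖ b n)) ⟨
    coeff (a ⊕ ⊖ b) n       ≈⟨ coeff-≈ (all≈0⇒≋[] a-b≈0) n ⟩
    0#                      ∎)
    where
    open import Algebra.Properties.Ring ring using (x∙y⁻¹≈ε⇒x≈y)
    all≈0⇒≋[] : ∀ {u} → All (_≈ 0#) u → u ≋ []
    all≈0⇒≋[] []             = ≋-refl
    all≈0⇒≋[] (x≈0 ∷ u≈0) = coeffwise λ { zero → x≈0 ; (suc n) → coeff-≈ (all≈0⇒≋[] u≈0) n }

  ≋⇒≈ₚ : ∀ {a b} → a ≋ b → _≈ₚ_ F a b
  ≋⇒≈ₚ {a} {b} a≋b = ≋[]⇒all≈0 (a ⊕ ⊖ b) (coeffwise λ n → begin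
    coeff (a ⊕ ⊖ b) n       ≈⟨ trans (coeff-⊕ a (⊖ b) n) (+-congˡ (coeff-⊖ b n)) ⟩
    coeff a n - coeff b n   ≈⟨ +-congʳ (coeff-≈ a≋b n) ⟩
    coeff b n - coeff b n   ≈⟨ -‿inverseʳ _ ⟩
    0#                      ∎)
    where
    ≋[]⇒all≈0 : ∀ u → u ≋ [] → All (_≈ 0#) u
    ≋[]⇒all≈0 []      _    = []
    ≋[]⇒all≈0 (x ∷ u) u≋0 = coeff-≈ u≋0 0 ∷ ≋[]⇒all≈0 u (∷≋[]⇒≋[] u≋0)

module PrincipalQuotient {c ℓ} (R : CommutativeRing c ℓ) (p : CommutativeRing.Carrier R) where
  open CommutativeRing R
  open RingLemmas R
  open RingDivisibility R
  open import Algebra.Properties.Ring ring using (x≈y⇒x∙y⁻¹≈ε; ⁻¹-anti-homo‿-; -‿+-comm)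

  infix 4 _≈ᵖ_
  _≈ᵖ_ : Rel Carrier (c ⊔ ℓ)
  a ≈ᵖ b = p ∣ a - b

  ≈⇒≈ᵖ : ∀ {a b} → a ≈ b → a ≈ᵖ b
  ≈⇒≈ᵖ a≈b = ∣ʳ-respʳ-≈ (sym (x≈y⇒x∙y⁻¹≈ε a≈b)) (p ∣0)

  x≈cp+y⇒x≈ᵖy : ∀ {x y} c → x ≈ c * p + y → x ≈ᵖ y
  x≈cp+y⇒x≈ᵖy {x} {y} c x≈cp+y = c , (begin
    c * p              ≈⟨ +-identityʳ (c * p) ⟨
    c * p + 0#         ≈⟨ +-congˡ (-‿inverseʳ y) ⟨
    c * p + (y - y)    ≈⟨ +-assoc (c * p) y (- y) ⟨
    (c * p + y) - y    ≈⟨ +-congʳ x≈cp+y ⟨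
    x - y              ∎)
    where open import Relation.Binary.Reasoning.Setoid setoid

  ≈ᵖ-sym : ∀ {a b} → a ≈ᵖ b → b ≈ᵖ a
  ≈ᵖ-sym {a} {b} a≈ᵖb = ∣ʳ-respʳ-≈ (⁻¹-anti-homo‿- a b) (x∣y⇒x∣-y a≈ᵖb)

  ≈ᵖ-trans : ∀ {a b c} → a ≈ᵖ b → b ≈ᵖ c → a ≈ᵖ c
  ≈ᵖ-trans {a} {b} {c} a≈ᵖb b≈ᵖc = ∣ʳ-respʳ-≈ ([x-y]+[y-z]≈x-z a b c) (x∣y∧x∣z⇒x∣y+z a≈ᵖb b≈ᵖc)

  +-congᵖ : ∀ {a a′ b b′} → a ≈ᵖ a′ → b ≈ᵖ b′ → a + b ≈ᵖ a′ + b′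
  +-congᵖ {a} {a′} {b} {b′} a≈ᵖa′ b≈ᵖb′ =
    ∣ʳ-respʳ-≈ (sym ([x+y]-[u+v]≈[x-u]+[y-v] a b a′ b′)) (x∣y∧x∣z⇒x∣y+z a≈ᵖa′ b≈ᵖb′)

  -‿congᵖ : ∀ {a a′} → a ≈ᵖ a′ → - a ≈ᵖ - a′
  -‿congᵖ {a} {a′} a≈ᵖa′ = ∣ʳ-respʳ-≈ (sym (-‿+-comm a (- a′))) (x∣y⇒x∣-y a≈ᵖa′)

  *-congᵖ : ∀ {a a′ b b′} → a ≈ᵖ a′ → b ≈ᵖ b′ → a * b ≈ᵖ a′ * b′
  *-congᵖ {a} {a′} {b} {b′} a≈ᵖa′ b≈ᵖb′ =
    ∣ʳ-respʳ-≈ (sym (xy-uv≈x[y-v]+[x-u]v a b a′ b′)) (x∣y∧x∣z⇒x∣y+z (x∣ʳy⇒x∣ʳzy a b≈ᵖb′) (x∣y⇒x∣yz b′ a≈ᵖa′))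

  quotientRing : CommutativeRing c (c ⊔ ℓ)
  quotientRing = record
    { Carrier = Carrier
    ; _≈_ = _≈ᵖ_
    ; isCommutativeRing = record
      { isRing = record
        { +-isAbelianGroup = record
          { isGroup = record
            { isMonoid = record
              { isSemigroup = record
                { isMagma = record
                  { isEquivalence = record { refl = ≈⇒≈ᵖ refl ; sym = ≈ᵖ-sym ; trans = ≈ᵖ-trans }
                  ; ∙-cong = +-congᵖ }
                ; assoc = λ x y z → ≈⇒≈ᵖ (+-assoc x y z) }
              ; identity = (λ x → ≈⇒≈ᵖ (+-identityˡ x)) , (λ x → ≈⇒≈ᵖ (+-identityʳ x)) }
            ; inverse = (λ x → ≈⇒≈ᵖ (-‿inverseˡ x)) , (λ x → ≈⇒≈ᵖ (-‿inverseʳ x))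
            ; ⁻¹-cong = -‿congᵖ }
          ; comm = λ x y → ≈⇒≈ᵖ (+-comm x y) }
        ; *-cong = *-congᵖ
        ; *-assoc = λ x y z → ≈⇒≈ᵖ (*-assoc x y z)
        ; *-identity = (λ x → ≈⇒≈ᵖ (*-identityˡ x)) , (λ x → ≈⇒≈ᵖ (*-identityʳ x))
        ; distrib = (λ x y z → ≈⇒≈ᵖ (distribˡ x y z)) , (λ x y z → ≈⇒≈ᵖ (distribʳ x y z)) }
      ; *-comm = λ x y → ≈⇒≈ᵖ (*-comm x y) } }

module PolynomialDivision (F : CommutativeRing 0ℓ 0ℓ) (isField : IsField F)
  (_≟_ : Decidable (CommutativeRing._≈_ F)) where
  open Polynomials F
  private module F = CommutativeRing F
  open CommutativeRing polyRing
  open RingDivisibility polyRing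
  open RingLemmas polyRing using (a≈qb+r∧g≈sb+tr⇒g≈ta+[s-tq]b)
  open import Relation.Binary.Reasoning.Setoid setoid

  T : A
  T = Tₚ F

  opaque
    unfolding _+ᴬ_ _*ᴬ_ -ᴬ_

    ∷≈[x]+T* : ∀ x a → (x ∷ a) ≈ (x ∷ []) + T * a
    ∷≈[x]+T* x a = coeffwise λ n → F.sym (F.trans (coeff-⊕ (x ∷ []) (T ⊗ a) n) (F.trans
      (F.+-congˡ (F.trans (coeff-⊗ F.0# (F.1# ∷ []) a n)
        (F.trans (F.+-cong (F.zeroˡ _) (coeff-≈ (0∷-cong (⊗-identityˡ a)) n)) (F.+-identityˡ _))))
      (tail-coeff n)))
      where
      tail-coeff : ∀ n → coeff (x ∷ []) n F.+ coeff (F.0# ∷ a) n F.≈ coeff (x ∷ a) n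
      tail-coeff zero    = F.+-identityʳ x
      tail-coeff (suc n) = F.+-identityˡ _

    [c]*≈· : ∀ c u → (c ∷ []) * u ≈ c · u
    [c]*≈· c u = coeffwise λ n →
      F.trans (coeff-⊕ (c · u) (F.0# ∷ []) n) (F.trans (F.+-congˡ (coeff-0∷ n)) (F.+-identityʳ _))

    ++[t]≈ : ∀ i v → length i ≡ length v → ∀ {t s} → t F.≈ s → (i ++ [ t ]) ≈ (i - v) + (v ++ [ s ])
    ++[t]≈ []      []      _        t≈s = coeffwise λ { zero → t≈s ; (suc n) → F.refl }
    ++[t]≈ (x ∷ i) (y ∷ v) |i|≡|v| t≈s = ∷-cong x≈x-y+y (++[t]≈ i v (ℕ.suc-injective |i|≡|v|) t≈s)
      where
      x≈x-y+y : x F.≈ (x F.- y) F.+ y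
      x≈x-y+y = F.sym (F.trans (F.+-assoc x (F.- y) y) (F.trans (F.+-congˡ (F.-‿inverseˡ y)) (F.+-identityʳ x)))

    length-sub : ∀ i v → length i ≡ length v → length (i - v) ≡ length i
    length-sub []      []      _        = ≡.refl
    length-sub (x ∷ i) (y ∷ v) |i|≡|v| = ≡.cong suc (length-sub i v (ℕ.suc-injective |i|≡|v|))

  replicate-0≈0 : ∀ n → replicate n F.0# ≈ 0#
  replicate-0≈0 zero    = refl
  replicate-0≈0 (suc n) = coeffwise λ { zero → F.refl ; (suc k) → coeff-≈ (replicate-0≈0 n) k }

  module _ (bs : A) {ℓ ℓ⁻¹ : F.Carrier} (ℓℓ⁻¹≈1 : ℓ F.* ℓ⁻¹ F.≈ F.1#) where
    private
      b : A
      b = bs ++ [ ℓ ]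

    eliminate-leading : ∀ i t → length i ≡ length bs →
                        ∃₂ λ c r → length r ≡ length bs × (i ++ [ t ]) ≈ [ c ] * b + r
    eliminate-leading i t |i|≡|bs| = c , i - c · bs , |i-cbs|≡|bs| , (begin
      i ++ [ t ]                       ≈⟨ ++[t]≈ i (c · bs) |i|≡|cbs| t≈cℓ ⟩
      (i - c · bs) + (c · bs ++ [ c F.* ℓ ]) ≡⟨ ≡.cong ((i - c · bs) +_) (map-++ (c F.*_) bs [ ℓ ]) ⟨
      (i - c · bs) + c · b             ≈⟨ +-congˡ ([c]*≈· c b) ⟨
      (i - c · bs) + [ c ] * b         ≈⟨ +-comm (i - c · bs) ([ c ] * b) ⟩
      [ c ] * b + (i - c · bs)         ∎)
      where
      c : F.Carrier
      c = t F.* ℓ⁻¹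
      |i|≡|cbs| : length i ≡ length (c · bs)
      |i|≡|cbs| = ≡.trans |i|≡|bs| (≡.sym (length-map (c F.*_) bs))
      |i-cbs|≡|bs| : length (i - c · bs) ≡ length bs
      |i-cbs|≡|bs| = ≡.trans (length-sub i (c · bs) |i|≡|cbs|) |i|≡|bs|
      t≈cℓ : t F.≈ c F.* ℓ
      t≈cℓ = F.sym (F.trans (F.*-assoc t ℓ⁻¹ ℓ) (F.trans (F.*-congˡ (F.trans (F.*-comm ℓ⁻¹ ℓ) ℓℓ⁻¹≈1)) (F.*-identityʳ t)))

    divide : ∀ a → ∃₂ λ q r → length r ≡ length bs × a ≈ q * b + r
    divide [] = 0# , replicate (length bs) F.0# , length-replicate (length bs) , (begin
      []                                      ≈⟨ replicate-0≈0 (length bs) ⟨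
      replicate (length bs) F.0#              ≈⟨ +-identityˡ _ ⟨
      0# + replicate (length bs) F.0#         ≈⟨ +-congʳ (zeroˡ b) ⟨
      0# * b + replicate (length bs) F.0#     ∎)
    divide (x ∷ a)
      with q , r , |r|≡|bs| , a≈qb+r ← divide a
      with i , t , x∷r≡i++[t] , |i|≡|r| ← ∷-initLast x r
      with c , r′ , |r′|≡|bs| , i++[t]≈cb+r′ ← eliminate-leading i t (≡.trans |i|≡|r| |r|≡|bs|) =
      T * q + [ c ] , r′ , |r′|≡|bs| , (begin
        x ∷ a                                  ≈⟨ ∷≈[x]+T* x a ⟩
        [ x ] + T * a                          ≈⟨ +-congˡ (*-congˡ a≈qb+r) ⟩
        [ x ] + T * (q * b + r)                ≈⟨ +-congˡ (distribˡ T (q * b) r) ⟩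
        [ x ] + (T * (q * b) + T * r)          ≈⟨ x∙yz≈y∙xz [ x ] (T * (q * b)) (T * r) ⟩
        T * (q * b) + ([ x ] + T * r)          ≈⟨ +-cong (*-assoc T q b) (∷≈[x]+T* x r) ⟨
        (T * q) * b + (x ∷ r)                  ≡⟨ ≡.cong ((T * q) * b +_) x∷r≡i++[t] ⟩
        (T * q) * b + (i ++ [ t ])             ≈⟨ +-congˡ i++[t]≈cb+r′ ⟩
        (T * q) * b + ([ c ] * b + r′)         ≈⟨ +-assoc ((T * q) * b) ([ c ] * b) r′ ⟨
        ((T * q) * b + [ c ] * b) + r′         ≈⟨ +-congʳ (distribʳ b (T * q) [ c ]) ⟨
        (T * q + [ c ]) * b + r′               ∎)
      where open import Algebra.Properties.CommutativeSemigroup +-commutativeSemigroup using (x∙yz≈y∙xz)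

  divide-monic : ∀ {b} (monic : Monic F b) a → ∃₂ λ q r → length r ≡ length (proj₁ monic) × a ≈ q * b + r
  divide-monic (bs , ℓ , ≡.refl , ℓ≈1) = divide bs (F.trans (F.*-identityʳ ℓ) ℓ≈1)

  data Trimmed : A → Set where
    []      : Trimmed []
    leading : ∀ bs {ℓ} → ℓ F.≉ F.0# → Trimmed (bs ++ [ ℓ ])

  trim : ∀ b → ∃ λ b′ → b′ ≈ b × length b′ ≤ length b × Trimmed b′
  trim [] = [] , refl , z≤n , []
  trim (x ∷ b) with trim b
  ... | b′ , b′≈b , |b′|≤|b| , leading bs ℓ≉0 = x ∷ b′ , ∷-cong F.refl b′≈b , s≤s |b′|≤|b| , leading (x ∷ bs) ℓ≉0
  ... | _ , []≈b , _ , [] with x ≟ F.0#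
  ...   | yes x≈0 = [] , coeffwise (λ { zero → F.sym x≈0 ; (suc n) → coeff-≈ []≈b n }) , z≤n , []
  ...   | no  x≉0 = [ x ] , ∷-cong F.refl []≈b , s≤s z≤n , leading [] x≉0

  Bezout : A → A → Set
  Bezout a b = ∃ λ g → g ∣ a × g ∣ b × ∃₂ λ s t → g ≈ s * a + t * b

  bezout-bounded : ∀ {n} a b → length b < n → Bezout a b
  bezout-bounded {suc n} a b (s≤s |b|≤n) with trim b
  ... | _ , []≈b , _ , [] =
    a , ∣ʳ-refl , ∣ʳ-respʳ-≈ []≈b (a ∣0) , 1# , 0# , (begin
      a               ≈⟨ *-identityˡ a ⟨
      1# * a          ≈⟨ +-identityʳ (1# * a) ⟨
      1# * a + 0#     ≈⟨ +-congˡ (zeroˡ b) ⟨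
      1# * a + 0# * b ∎)
  ... | _ , b′≈b , |b′|≤|b| , leading bs {ℓ} ℓ≉0
    with ℓ⁻¹ , ℓℓ⁻¹≈1 ← FieldProperties.inverse F isField ℓ ℓ≉0
    with q , r , |r|≡|bs| , a≈qb′+r ← divide bs ℓℓ⁻¹≈1 a
    with g , g∣b′ , g∣r , s , t , g≈sb′+tr ← bezout-bounded (bs ++ [ ℓ ]) r
           (ℕ.≤-trans (ℕ.≤-reflexive (≡.trans (≡.cong suc |r|≡|bs|) (≡.sym (length-++[x] bs ℓ))))
                      (ℕ.≤-trans |b′|≤|b| |b|≤n)) =
    g , ∣ʳ-respʳ-≈ (sym a≈qb′+r) (x∣y∧x∣z⇒x∣y+z (x∣ʳy⇒x∣ʳzy q g∣b′) g∣r) , ∣ʳ-respʳ-≈ b′≈b g∣b′ ,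
    t , s - t * q , trans (a≈qb+r∧g≈sb+tr⇒g≈ta+[s-tq]b a≈qb′+r g≈sb′+tr) (+-congˡ (*-congˡ b′≈b))

  bezout : ∀ a b → Bezout a b
  bezout a b = bezout-bounded a b (ℕ.n<1+n (length b))

module _ (F : CommutativeRing 0ℓ 0ℓ) {q} (card : HasCard F q) where
  open CommutativeRing F

  private
    e : Fin q → Carrier
    e = proj₁ card

  hasCard⇒decidable : Decidable _≈_
  hasCard⇒decidable x y with i , eᵢ≈x ← proj₂ (proj₂ card) x | j , eⱼ≈y ← proj₂ (proj₂ card) y with i Fin.≟ j
  ... | yes ≡.refl = yes (trans (sym eᵢ≈x) eⱼ≈y)
  ... | no  i≢j    = no λ x≈y → i≢j (proj₁ (proj₂ card) i j (trans eᵢ≈x (trans x≈y (sym eⱼ≈y))))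

  hasCard⇒enumeration : IsEnumeration setoid (tabulate e)
  hasCard⇒enumeration x with i , eᵢ≈x ← proj₂ (proj₂ card) x = ∈-resp-≈ setoid eᵢ≈x (∈-tabulate⁺ setoid i)

module PolynomialEnumeration (F : CommutativeRing 0ℓ 0ℓ) {elements : List (CommutativeRing.Carrier F)}
  (enumerates : IsEnumeration (CommutativeRing.setoid F) elements) where
  open Polynomials F
  open CommutativeRing polyRing using (setoid)
  open import Data.List.Membership.Setoid setoid using (_∈_)

  polynomialsOfLength : ℕ → List A
  polynomialsOfLength zero    = [ [] ]
  polynomialsOfLength (suc n) = cartesianProductWith _∷_ elements (polynomialsOfLength n)

  ∈-polynomialsOfLength : ∀ a → a ∈ polynomialsOfLength (length a)
  ∈-polynomialsOfLength []      = Any.here ≋-refl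
  ∈-polynomialsOfLength (x ∷ a) = ∈-cartesianProductWith⁺ (CommutativeRing.setoid F) setoid setoid ∷-cong
    (enumerates x) (∈-polynomialsOfLength a)

module ResidueField (F : CommutativeRing 0ℓ 0ℓ) {q} (isField : IsField F) (card : HasCard F q)
  (p : Poly F) (monic : Monic F p) (irreducible : Irreducible F p) where
  open Polynomials F
  open PolynomialDivision F isField (hasCard⇒decidable F card)
  open CommutativeRing polyRing
  open RingDivisibility polyRing
  open RingLemmas polyRing using (x-0#≈x)
  open PrincipalQuotient polyRing p public
  open import Algebra.Properties.CommutativeSemigroup *-commutativeSemigroup using (xy∙z≈xz∙y)
  open import Relation.Binary.Reasoning.Setoid setoid

  UnitA⇒ : ∀ {a} → UnitA F a → ∃ λ b → a * b ≈ 1#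
  UnitA⇒ {a} (b , ab≈ₚ1) = b , trans (reflexive (*ᴬ≡⊗ a b)) (≈ₚ⇒≋ ab≈ₚ1)

  ⇒UnitA : ∀ {a b} → a * b ≈ 1# → UnitA F a
  ⇒UnitA {a} {b} ab≈1 = b , ≋⇒≈ₚ (trans (reflexive (≡.sym (*ᴬ≡⊗ a b))) ab≈1)

  divisible-or-invertible : ∀ a → p ∣ a ⊎ ∃ λ b → a * b ≈ᵖ 1#
  divisible-or-invertible a with g , (k , kg≈p) , g∣a , s , t , g≈sp+ta ← bezout p a
    with proj₂ (proj₂ irreducible) k g (≋⇒≈ₚ (trans (sym kg≈p) (reflexive (*ᴬ≡⊗ k g))))
  ... | inj₁ k-unit with k′ , kk′≈1 ← UnitA⇒ k-unit = inj₁ (∣ʳ-trans (k′ , (begin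
    k′ * p          ≈⟨ *-congˡ kg≈p ⟨
    k′ * (k * g)    ≈⟨ *-assoc k′ k g ⟨
    (k′ * k) * g    ≈⟨ *-congʳ (trans (*-comm k′ k) kk′≈1) ⟩
    1# * g          ≈⟨ *-identityˡ g ⟩
    g               ∎)) g∣a)
  ... | inj₂ g-unit with g′ , gg′≈1 ← UnitA⇒ g-unit = inj₂ (t * g′ , ≈ᵖ-sym (x≈cp+y⇒x≈ᵖy (s * g′) (begin
    1#                          ≈⟨ gg′≈1 ⟨
    g * g′                      ≈⟨ *-congʳ g≈sp+ta ⟩
    (s * p + t * a) * g′        ≈⟨ distribʳ g′ (s * p) (t * a) ⟩
    s * p * g′ + t * a * g′     ≈⟨ +-cong (xy∙z≈xz∙y s p g′) (trans (*-congʳ (*-comm t a)) (*-assoc a t g′)) ⟩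
    s * g′ * p + a * (t * g′)   ∎)))

  residueField : CommutativeRing 0ℓ 0ℓ
  residueField = quotientRing

  1≉ᵖ0 : ¬ 1# ≈ᵖ 0#
  1≉ᵖ0 (c , cp≈1-0) = proj₁ (proj₂ irreducible) (⇒UnitA (begin
    p * c      ≈⟨ *-comm p c ⟩
    c * p      ≈⟨ cp≈1-0 ⟩
    1# - 0#    ≈⟨ x-0#≈x 1# ⟩
    1#         ∎))

  residueField-isField : IsField residueField
  residueField-isField = 1≉ᵖ0 , λ a a≉ᵖ0 → invertible a a≉ᵖ0 (divisible-or-invertible a)
    where
    invertible : ∀ a → ¬ a ≈ᵖ 0# → p ∣ a ⊎ ∃ (λ b → a * b ≈ᵖ 1#) → ∃ λ b → a * b ≈ᵖ 1#
    invertible a a≉ᵖ0 (inj₁ p∣a) = contradiction (∣ʳ-respʳ-≈ (sym (x-0#≈x a)) p∣a) a≉ᵖ0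
    invertible a a≉ᵖ0 (inj₂ a⁻¹) = a⁻¹

  _≟ᵖ_ : Decidable _≈ᵖ_
  a ≟ᵖ b with divisible-or-invertible (a - b)
  ... | inj₁ p∣a-b = yes p∣a-b
  ... | inj₂ (c , [a-b]c≈ᵖ1) = no λ a≈ᵖb →
    1≉ᵖ0 (R.trans (R.sym [a-b]c≈ᵖ1) (R.trans (R.*-congʳ (x≈y⇒x∙y⁻¹≈ε a≈ᵖb)) (R.zeroˡ c)))
    where
    module R = CommutativeRing residueField
    open import Algebra.Properties.Ring R.ring using (x≈y⇒x∙y⁻¹≈ε)

  open PolynomialEnumeration F (hasCard⇒enumeration F card)

  residues : List A
  residues = polynomialsOfLength (length (proj₁ monic))

  residues-enumerate : IsEnumeration (CommutativeRing.setoid residueField) residues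
  residues-enumerate a
    with k , r , |r|≡|cs| , a≈kp+r ← divide-monic monic a =
    Any.map (λ r≋b → ≈ᵖ-trans (x≈cp+y⇒x≈ᵖy k a≈kp+r) (≈⇒≈ᵖ r≋b))
      (≡.subst (λ n → Any (r ≋_) (polynomialsOfLength n)) |r|≡|cs| (∈-polynomialsOfLength r))

oddPrimePower⇒1<q : ∀ {q} → OddPrimePower q → 1 < q
oddPrimePower⇒1<q {zero} (ℓ , k , ℓ-prime , _ , 0≡ℓ^k , _) =
  contradiction (≡.subst Prime (ℕ.m^n≡0⇒m≡0 ℓ k (≡.sym 0≡ℓ^k)) ℓ-prime) ¬prime[0]
oddPrimePower⇒1<q {suc zero} (ℓ , k , ℓ-prime , 1≤k , 1≡ℓ^k , _) with ℕ.m^n≡1⇒n≡0∨m≡1 ℓ k (≡.sym 1≡ℓ^k)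
... | inj₁ ≡.refl = contradiction 1≤k λ ()
... | inj₂ ≡.refl = contradiction ℓ-prime ¬prime[1]
oddPrimePower⇒1<q {suc (suc _)} _ = s≤s (s≤s z≤n)

module DrinfeldClasses (F : CommutativeRing 0ℓ 0ℓ) (k : ℕ) (isField : IsField F) (card : HasCard F (2 ℕ.+ k))
  (p : Poly F) (monic : Monic F p) (irreducible : Irreducible F p) where
  open Polynomials F
  open ResidueField F isField card p monic irreducible
  open CommutativeRing polyRing
  open RingDivisibility polyRing using (_,_)
  open Fp F (2 ℕ.+ k) p using (_≡ₘ_; powₚ; frob; φT; Isomorphic; DistinctClasses)

  private
    q : ℕ
    q = 2 ℕ.+ k
    module R = CommutativeRing residueField
  open import Algebra.Properties.Semiring.Exp R.semiring using (_^_; ^-congˡ; ^-assocʳ)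

  -ₚ≡- : ∀ a b → _-ₚ_ F a b ≡ a - b
  -ₚ≡- a b = ≡.sym (≡.trans (+ᴬ≡⊕ a (-ᴬ b)) (≡.cong (a ⊕_) (-ᴬ≡⊖ b)))

  ≡ₘ⇒≈ᵖ : ∀ {a b} → a ≡ₘ b → a ≈ᵖ b
  ≡ₘ⇒≈ᵖ {a} {b} (c , a-b≈ₚcp) =
    c , sym (trans (reflexive (≡.sym (-ₚ≡- a b))) (trans (≈ₚ⇒≋ a-b≈ₚcp) (reflexive (≡.sym (*ᴬ≡⊗ c p)))))

  ≈ᵖ⇒≡ₘ : ∀ {a b} → a ≈ᵖ b → a ≡ₘ b
  ≈ᵖ⇒≡ₘ {a} {b} (c , cp≈a-b) =
    c , ≋⇒≈ₚ (trans (reflexive (-ₚ≡- a b)) (trans (sym cp≈a-b) (reflexive (*ᴬ≡⊗ c p))))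

  powₚ≈^ : ∀ a n → powₚ a n ≈ᵖ a ^ n
  powₚ≈^ a zero    = R.refl
  powₚ≈^ a (suc n) = R.trans (≈⇒≈ᵖ (reflexive (≡.sym (*ᴬ≡⊗ a (powₚ a n))))) (R.*-congˡ (powₚ≈^ a n))

  frob²≈^q² : ∀ a → frob (frob a) ≈ᵖ a ^ (q ℕ.* q)
  frob²≈^q² a = R.trans (powₚ≈^ (frob a) q) (R.trans (^-congˡ q (powₚ≈^ a q)) (^-assocʳ a q q))

  -ₚ≡ₘ[] : ∀ {u v} → u ≈ᵖ v → _-ₚ_ F u v ≡ₘ []
  -ₚ≡ₘ[] {u} {v} u≈ᵖv = ≈ᵖ⇒≡ₘ (≡.subst (_≈ᵖ 0#) (≡.sym (-ₚ≡- u v)) (x≈y⇒x∙y⁻¹≈ε u≈ᵖv))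
    where open import Algebra.Properties.Ring R.ring using (x≈y⇒x∙y⁻¹≈ε)

  -- In Defs, τ·(a *τ b) raises whole coefficients of a *τ b to the q-th power, so the
  -- τ²-coefficient of φ(0,δ′)_T [μ] is (δ′μ)^(q²); its τ⁰- and τ¹-coefficients are T̂μ and 0^q.
  μδ≈[δ′μ]^q²⇒isomorphic : ∀ {δ δ′} → (∃ λ μ → ¬ μ ≈ᵖ 0# × μ * δ ≈ᵖ (δ′ * μ) ^ (q ℕ.* q)) →
                           Isomorphic (φT [] δ) (φT [] δ′)
  μδ≈[δ′μ]^q²⇒isomorphic {δ} {δ′} (μ , μ≉ᵖ0 , μδ≈ᵖ[δ′μ]^q²) =
    μ , (λ μ≡ₘ0 → μ≉ᵖ0 (≡ₘ⇒≈ᵖ μ≡ₘ0)) , τ⁰ ∷ τ¹ ∷ τ² ∷ []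
    where
    T : A
    T = Tₚ F
    τ⁰ : _-ₚ_ F (μ ⊗ T ⊕ []) (T ⊗ μ ⊕ []) ≡ₘ []
    τ⁰ = -ₚ≡ₘ[] (≈⇒≈ᵖ (⊕-cong (⊗-comm μ T) ≋-refl))
    τ¹ : _-ₚ_ F (μ ⊗ []) (frob []) ≡ₘ []
    τ¹ = -ₚ≡ₘ[] (≈⇒≈ᵖ (⊗-zeroʳ μ))
    τ² : _-ₚ_ F (μ ⊗ δ) (frob (frob (δ′ ⊗ μ ⊕ []))) ≡ₘ []
    τ² = -ₚ≡ₘ[] (begin
      μ ⊗ δ                           ≈⟨ ≈⇒≈ᵖ (reflexive (≡.sym (*ᴬ≡⊗ μ δ))) ⟩
      μ * δ                           ≈⟨ μδ≈ᵖ[δ′μ]^q² ⟩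
      (δ′ * μ) ^ (q ℕ.* q)            ≈⟨ ^-congˡ (q ℕ.* q) (≈⇒≈ᵖ δ′μ≈δ′⊗μ⊕[]) ⟩
      (δ′ ⊗ μ ⊕ []) ^ (q ℕ.* q)       ≈⟨ frob²≈^q² (δ′ ⊗ μ ⊕ []) ⟨
      frob (frob (δ′ ⊗ μ ⊕ []))       ∎)
      where
      open import Relation.Binary.Reasoning.Setoid R.setoid
      δ′μ≈δ′⊗μ⊕[] : δ′ * μ ≈ δ′ ⊗ μ ⊕ []
      δ′μ≈δ′⊗μ⊕[] = trans (reflexive (*ᴬ≡⊗ δ′ μ)) (≋-sym (⊕-identityʳ (δ′ ⊗ μ)))

  distinctClasses-length≤ : ∀ {ds} → DistinctClasses ds → length ds ≤ q ℕ.* q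
  distinctClasses-length≤ {ds} (ds≢0 , ds-nonIsomorphic) =
    ℕ.≤-trans (sameCosetClasses-length≤ n ds≉0 ds-apart) (ℕ.n≤1+n (suc n))
    where
    open FieldProperties residueField residueField-isField using (SameCoset; sameCoset⇒μδ≈[δ′μ]^[1+m])
    open FiniteFieldCosets residueField residueField-isField _≟ᵖ_ residues-enumerate
    -- chosen so that suc (suc n) and q ℕ.* q are definitionally equal
    n : ℕ
    n = k ℕ.+ suc k ℕ.* q
    ds≉0 : All (λ δ → ¬ δ ≈ᵖ 0#) ds
    ds≉0 = All.map (λ δ≢0 δ≈ᵖ0 → δ≢0 (≈ᵖ⇒≡ₘ δ≈ᵖ0)) ds≢0
    ¬sameCoset : ∀ {δ δ′} → ¬ δ ≈ᵖ 0# → ¬ Isomorphic (φT [] δ) (φT [] δ′) → ¬ SameCoset (suc n) δ δ′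
    ¬sameCoset δ≉0 ¬iso δ~δ′ =
      ¬iso (μδ≈[δ′μ]^q²⇒isomorphic (sameCoset⇒μδ≈[δ′μ]^[1+m] {suc n} δ≉0 δ~δ′))
    ds-apart : AllPairs (λ δ δ′ → ¬ SameCoset (suc n) δ δ′) ds
    ds-apart = AllPairs-map-All ¬sameCoset ds≉0 ds-nonIsomorphic

distinctClasses-length≤q² : ∀ (F : CommutativeRing 0ℓ 0ℓ) {q} → 1 < q → IsField F → HasCard F q →
                            ∀ {p} → Monic F p → Irreducible F p →
                            ∀ {ds} → Fp.DistinctClasses F q p ds → length ds ≤ q ℕ.* q
distinctClasses-length≤q² F {suc (suc k)} (s≤s (s≤s _)) isField card {p} monic irreducible =
  DrinfeldClasses.distinctClasses-length≤ F k isField card p monic irreducible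

open import Data.Nat using (_*_; _^_)

lemma2p5 : Σ ℕ λ C → 0 < C ×
    ((F : CommutativeRing 0ℓ 0ℓ) (q : ℕ) → OddPrimePower q → IsField F → HasCard F q →
    (p : Poly F) → Monic F p → Irreducible F p →
    (ds : List (Poly F)) → Fp.DistinctClasses F q p ds →
    length ds ≤ C * q ^ 2)
lemma2p5 = 1 , s≤s z≤n , λ F q q-oddPrimePower isField card p monic irreducible ds classes → begin
  length ds     ≤⟨ distinctClasses-length≤q² F (oddPrimePower⇒1<q q-oddPrimePower)
                                             isField card monic irreducible classes ⟩
  q * q         ≡⟨ ≡.cong (q *_) (ℕ.*-identityʳ q) ⟨
  q ^ 2         ≡⟨ ℕ.*-identityˡ (q ^ 2) ⟨
  1 * q ^ 2     ∎
  where open ℕ.≤-Reasoning
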